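{- Let $G$ be a connected chordal graph with clique graph $C(G)$, and let $U$ and $U'$ be two units such that some edge of $C(G)$ crosses $U$ and $U'$. Then all edges of $C(G)$ crossing $U$ and $U'$ have the same label.
   Context: Graphs are finite, simple, undirected; a graph is chordal if it has no induced cycle of length greater than three. A $u$-$v$ separator of $G$ is a set $X\subseteq V(G)$ with $u,v$ in different components of $G-X$; it is minimal if no proper subset is a $u$-$v$ separator. The clique graph $C(G)$ has as nodes the maximal cliques of $G$; distinct nodes $K,K'$ are adjacent iff $K\cap K'$ is a minimal $u$-$v$ separator of $G$ for all $u\in K\setminus K'$ and $v\in K'\setminus K$; the edge $KK'$ has label $K\cap K'$ and weight $|K\cap K'|$. The units are the connected components of the graph obtained from $C(G)$ by deleting all edges whose weight equals the minimum edge weight of $C(G)$. An edge of $C(G)$ crosses units $U$ and $U'$ if one endpoint lies in $U$ and the other in $U'$. -}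

module Defs where

open import Data.Nat using (ℕ; zero; suc; _≤_)
open import Data.Fin using (Fin; toℕ)
open import Data.Fin.Subset using (Subset; _∈_; _∉_; _⊆_; _⊂_; _∩_; ∣_∣) renaming (⊥ to ∅)
open import Data.Bool using (Bool; true; false)
open import Data.Product using (_×_; ∃₂; Σ)
open import Data.Sum using (_⊎_)
open import Relation.Nullary using (¬_)
open import Relation.Binary.PropositionalEquality using (_≡_; _≢_)

record Graph (n : ℕ) : Set where
  field
    adj    : Fin n → Fin n → Bool
    sym    : ∀ u v → adj u v ≡ adj v u
    irrefl : ∀ u → adj u u ≡ false

open Graph public

module _ {n : ℕ} (G : Graph n) where

  Adj : Fin n → Fin n → Set
  Adj u v = adj G u v ≡ true

  data PathAvoiding (X : Subset n) : Fin n → Fin n → Set where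
    stop : ∀ {u} → u ∉ X → PathAvoiding X u u
    step : ∀ {u w v} → u ∉ X → Adj u w → PathAvoiding X w v → PathAvoiding X u v

  Connected : Set
  Connected = ∀ u v → PathAvoiding ∅ u v

  Separator : Subset n → Fin n → Fin n → Set
  Separator X u v = u ∉ X × v ∉ X × ¬ PathAvoiding X u v

  MinimalSeparator : Subset n → Fin n → Fin n → Set
  MinimalSeparator X u v = Separator X u v × (∀ Y → Y ⊂ X → ¬ Separator Y u v)

  CycNext : ∀ {k} → Fin k → Fin k → Set
  CycNext {k} i j = suc (toℕ i) ≡ toℕ j ⊎ (suc (toℕ i) ≡ k × toℕ j ≡ 0)

  CycAdj : ∀ {k} → Fin k → Fin k → Set
  CycAdj i j = CycNext i j ⊎ CycNext j i

  InducedCycle : (k : ℕ) → (Fin k → Fin n) → Set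
  InducedCycle k f =
    (∀ i j → f i ≡ f j → i ≡ j) ×
    (∀ i j → (Adj (f i) (f j) → CycAdj i j) × (CycAdj i j → Adj (f i) (f j)))

  Chordal : Set
  Chordal = ∀ k (f : Fin k → Fin n) → 4 ≤ k → ¬ InducedCycle k f

  Clique : Subset n → Set
  Clique K = ∀ u v → u ∈ K → v ∈ K → u ≢ v → Adj u v

  MaximalClique : Subset n → Set
  MaximalClique K = Clique K × (∀ K' → Clique K' → K ⊆ K' → K' ≡ K)

  CEdge : Subset n → Subset n → Set
  CEdge K K' = MaximalClique K × MaximalClique K' × K ≢ K' ×
    (∀ u v → u ∈ K → u ∉ K' → v ∈ K' → v ∉ K → MinimalSeparator (K ∩ K') u v)

  label : Subset n → Subset n → Subset n
  label K K' = K ∩ K'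

  weight : Subset n → Subset n → ℕ
  weight K K' = ∣ K ∩ K' ∣

  IsMinWeight : ℕ → Set
  IsMinWeight w = (∃₂ λ K K' → CEdge K K' × weight K K' ≡ w) ×
                  (∀ K K' → CEdge K K' → w ≤ weight K K')

  -- edges surviving the deletion of all minimum-weight edges
  KeptEdge : Subset n → Subset n → Set
  KeptEdge K K' = CEdge K K' × (∀ w → IsMinWeight w → weight K K' ≢ w)

  -- K and K' are nodes of C(G) in the same unit (component after deletion)
  data SameUnit : Subset n → Subset n → Set where
    here  : ∀ {K} → MaximalClique K → SameUnit K K
    there : ∀ {K L M} → KeptEdge K L → SameUnit L M → SameUnit K M

  -- the unit of node R is {K | SameUnit R K}; edge KK' crosses unit(R), unit(R')
  Crosses : Subset n → Subset n → Subset n → Subset n → Set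
  Crosses R R' K K' = CEdge K K' ×
    ((SameUnit R K × SameUnit R' K') ⊎ (SameUnit R' K × SameUnit R K'))

-- Let w be the minimum edge weight of C(G). An edge KK' crossing two distinct units is
-- not kept, so it has weight w, and its label S separates any u ∈ K ∖ K' from any
-- v ∈ K' ∖ K. Two cliques joined by a kept edge share more than w = |S| vertices, hence
-- one outside S, so all cliques of a unit meet the same component of G - S: the unit of
-- K meets that of u, the unit of K' that of v. A vertex outside S in the label of
-- another crossing edge would join these two components, so that label is contained
-- in S, and as it has weight w too, it equals S.
module Submission where

open import Defs hiding (sym)
open import Data.Nat using (ℕ; _≤_; _<_; s≤s)
open import Data.Nat.Properties using (≤-antisym; ≤-reflexive; ≤∧≢⇒<; <⇒≱; <-trans; n<1+n)
open import Data.Fin using (Fin) renaming (zero to fzero; suc to fsuc)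
open import Data.Fin.Properties using () renaming (_≟_ to _≟ᶠ_)
open import Data.Fin.Subset using (Subset; _∈_; _∉_; _⊆_; _∩_; ∣_∣; inside; outside)
open import Data.Fin.Subset.Properties
  using (_∈?_; drop-there; ⊆-antisym; x∈p∩q⁻; ∩-comm; p⊂q⇒∣p∣<∣q∣)
open import Data.Vec.Base using (_∷_; here; there)
open import Data.Vec.Properties using (≡-dec)
open import Data.Bool using (Bool)
open import Data.Bool.Properties using () renaming (_≟_ to _≟ᵇ_)
open import Data.Product using (∃; ∃₂; _×_; _,_; proj₁; proj₂)
open import Data.Sum using (_⊎_; inj₁; inj₂)
open import Data.Empty using (⊥-elim)
open import Function using (_∘_)
open import Relation.Nullary using (¬_; yes; no)
open import Relation.Nullary.Decidable using (decidable-stable)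
open import Relation.Nullary.Negation using (¬¬-Monad; contradiction)
open import Relation.Binary.PropositionalEquality using (_≡_; refl; sym; trans; cong; subst)
open import Effect.Monad using (RawMonad)
open import Level using (0ℓ)

∃∈∖-there : ∀ {n} {a b : Bool} {p q : Subset n} →
            (∃ λ x → x ∈ q × x ∉ p) → ∃ λ x → x ∈ b ∷ q × x ∉ a ∷ p
∃∈∖-there (x , x∈q , x∉p) = fsuc x , there x∈q , x∉p ∘ drop-there

∣p∣<∣q∣⇒∃∈q∖p : ∀ {n} (p q : Subset n) → ∣ p ∣ < ∣ q ∣ → ∃ λ x → x ∈ q × x ∉ p
∣p∣<∣q∣⇒∃∈q∖p (outside ∷ p) (inside ∷ q)  _        = fzero , here , λ ()
∣p∣<∣q∣⇒∃∈q∖p (inside ∷ p)  (inside ∷ q)  (s≤s lt) = ∃∈∖-there (∣p∣<∣q∣⇒∃∈q∖p p q lt)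
∣p∣<∣q∣⇒∃∈q∖p (outside ∷ p) (outside ∷ q) lt       = ∃∈∖-there (∣p∣<∣q∣⇒∃∈q∖p p q lt)
∣p∣<∣q∣⇒∃∈q∖p (inside ∷ p)  (outside ∷ q) lt       =
  ∃∈∖-there (∣p∣<∣q∣⇒∃∈q∖p p q (<-trans (n<1+n _) lt))

p⊆q∧∣q∣≤∣p∣⇒p≡q : ∀ {n} {p q : Subset n} → p ⊆ q → ∣ q ∣ ≤ ∣ p ∣ → p ≡ q
p⊆q∧∣q∣≤∣p∣⇒p≡q {p = p} {q} p⊆q ∣q∣≤∣p∣ = ⊆-antisym p⊆q q⊆p
  where
    q⊆p : q ⊆ p
    q⊆p {x} x∈q with x ∈? p
    ... | yes x∈p = x∈p
    ... | no  x∉p = contradiction ∣q∣≤∣p∣ (<⇒≱ (p⊂q⇒∣p∣<∣q∣ (p⊆q , x , x∈q , x∉p)))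

∉∩ʳ : ∀ {n} {x : Fin n} (p : Subset n) {q : Subset n} → x ∉ q → x ∉ p ∩ q
∉∩ʳ p {q} x∉q = x∉q ∘ proj₂ ∘ x∈p∩q⁻ p q

∉∩ˡ : ∀ {n} {x : Fin n} {p : Subset n} (q : Subset n) → x ∉ p → x ∉ p ∩ q
∉∩ˡ {p = p} q x∉p = x∉p ∘ proj₁ ∘ x∈p∩q⁻ p q

module _ {n : ℕ} (G : Graph n) where

  Adj-sym : ∀ {u v} → Adj G u v → Adj G v u
  Adj-sym {u} {v} uv = trans (Graph.sym G v u) uv

  infixr 5 _++_

  _++_ : ∀ {X u v w} → PathAvoiding G X u v → PathAvoiding G X v w → PathAvoiding G X u w
  stop _       ++ q = q
  step u∉X e p ++ q = step u∉X e (p ++ q)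

  source∉ : ∀ {X u v} → PathAvoiding G X u v → u ∉ X
  source∉ (stop u∉X)     = u∉X
  source∉ (step u∉X _ _) = u∉X

  reverse : ∀ {X u v} → PathAvoiding G X u v → PathAvoiding G X v u
  reverse (stop u∉X)     = stop u∉X
  reverse (step u∉X e p) = reverse p ++ step (source∉ p) (Adj-sym e) (stop u∉X)

  CEdge-sym : ∀ {K L} → CEdge G K L → CEdge G L K
  CEdge-sym {K} {L} (mK , mL , K≢L , sep) =
    mL , mK , K≢L ∘ sym ,
    λ u v u∈L u∉K v∈K v∉L →
      subst (λ X → MinimalSeparator G X u v) (∩-comm K L) (MinimalSeparator-sym (sep v u v∈K v∉L u∈L u∉K))
    where
      MinimalSeparator-sym : ∀ {X u v} → MinimalSeparator G X u v → MinimalSeparator G X v u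
      MinimalSeparator-sym ((u∉X , v∉X , ¬uv) , minimal) =
        (v∉X , u∉X , ¬uv ∘ reverse) ,
        λ Y Y⊂X (v∉Y , u∉Y , ¬vu) → minimal Y Y⊂X (u∉Y , v∉Y , ¬vu ∘ reverse)

  KeptEdge-sym : ∀ {K L} → KeptEdge G K L → KeptEdge G L K
  KeptEdge-sym {K} {L} (e , notMin) =
    CEdge-sym e , λ w min eq → notMin w min (trans (cong ∣_∣ (∩-comm K L)) eq)

  SameUnit-snoc : ∀ {K L M} → SameUnit G K L → KeptEdge G L M → SameUnit G K M
  SameUnit-snoc (here _)    e = there e (here (proj₁ (proj₂ (proj₁ e))))
  SameUnit-snoc (there e p) f = there e (SameUnit-snoc p f)

  SameUnit-sym : ∀ {K L} → SameUnit G K L → SameUnit G L K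
  SameUnit-sym (here mK)   = here mK
  SameUnit-sym (there e p) = SameUnit-snoc (SameUnit-sym p) (KeptEdge-sym e)

  SameUnit-trans : ∀ {K L M} → SameUnit G K L → SameUnit G L M → SameUnit G K M
  SameUnit-trans (here _)    q = q
  SameUnit-trans (there e p) q = there e (SameUnit-trans p q)

  IsMinWeight-unique : ∀ {w w′} → IsMinWeight G w → IsMinWeight G w′ → w ≡ w′
  IsMinWeight-unique ((K , K′ , e , refl) , min) ((L , L′ , e′ , refl) , min′) =
    ≤-antisym (min L L′ e′) (min′ K K′ e)

  crossing-not-kept : ∀ {R R′ K L} → ¬ SameUnit G R R′ → Crosses G R R′ K L → ¬ KeptEdge G K L
  crossing-not-kept ¬R~R′ (_ , inj₁ (R~K , R′~L)) kept =
    ¬R~R′ (SameUnit-trans (SameUnit-snoc R~K kept) (SameUnit-sym R′~L))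
  crossing-not-kept ¬R~R′ (_ , inj₂ (R′~K , R~L)) kept =
    ¬R~R′ (SameUnit-trans R~L (SameUnit-sym (SameUnit-snoc R′~K kept)))

  ¬kept⇒weight-min : ∀ {K L} → CEdge G K L → ¬ KeptEdge G K L → ¬ ¬ IsMinWeight G (weight G K L)
  ¬kept⇒weight-min e ¬kept ¬min = ¬kept (e , λ { _ min refl → ¬min min })

  CEdge⇒¬¬∃∈∖ : ∀ {K L} → CEdge G K L → ¬ ¬ (∃ λ u → u ∈ K × u ∉ L)
  CEdge⇒¬¬∃∈∖ {K} {L} (mK , mL , K≢L , _) ¬∃ = K≢L (sym (proj₂ mK L (proj₁ mL) K⊆L))
    where
      K⊆L : K ⊆ L
      K⊆L {x} x∈K with x ∈? L
      ... | yes x∈L = x∈L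
      ... | no  x∉L = ⊥-elim (¬∃ (x , x∈K , x∉L))

  Reaches : Subset n → Fin n → Subset n → Set
  Reaches S a K = ∀ x → x ∈ K → x ∉ S → PathAvoiding G S a x

  Clique⇒Reaches : ∀ {S a K x} → Clique G K → x ∈ K → x ∉ S → PathAvoiding G S a x → Reaches S a K
  Clique⇒Reaches {x = x} clique x∈K x∉S ax y y∈K y∉S with x ≟ᶠ y
  ... | yes refl = ax
  ... | no  x≢y  = ax ++ step x∉S (clique x y x∈K y∈K x≢y) (stop y∉S)

  Reaches-join : ∀ {S a b K L x} → Reaches S a K → Reaches S b L → x ∈ K → x ∈ L → x ∉ S →
                 PathAvoiding G S a b
  Reaches-join reachesK reachesL x∈K x∈L x∉S = reachesK _ x∈K x∉S ++ reverse (reachesL _ x∈L x∉S)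

  module MinWeightSeparator (S : Subset n) (S-min : IsMinWeight G ∣ S ∣) where

    kept⇒∣S∣<weight : ∀ {K L} → KeptEdge G K L → ∣ S ∣ < weight G K L
    kept⇒∣S∣<weight (e , notMin) = ≤∧≢⇒< (proj₂ S-min _ _ e) (λ eq → notMin _ S-min (sym eq))

    kept⇒Reaches : ∀ {a K L} → KeptEdge G K L → Reaches S a K → Reaches S a L
    kept⇒Reaches {K = K} {L} kept@((_ , (cliqueL , _) , _) , _) reachesK
      with ∣p∣<∣q∣⇒∃∈q∖p S (K ∩ L) (kept⇒∣S∣<weight kept)
    ... | x , x∈K∩L , x∉S =
      Clique⇒Reaches cliqueL (proj₂ (x∈p∩q⁻ K L x∈K∩L)) x∉S (reachesK x (proj₁ (x∈p∩q⁻ K L x∈K∩L)) x∉S)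

    SameUnit⇒Reaches : ∀ {a K L} → SameUnit G K L → Reaches S a K → Reaches S a L
    SameUnit⇒Reaches (here _)    reachesK = reachesK
    SameUnit⇒Reaches (there e p) reachesK = SameUnit⇒Reaches p (kept⇒Reaches e reachesK)

    crossing-label⊆ : ∀ {a b R R′} → ¬ PathAvoiding G S a b → Reaches S a R → Reaches S b R′ →
                      ∀ {K L} → Crosses G R R′ K L → K ∩ L ⊆ S
    crossing-label⊆ ¬ab reachesR reachesR′ {K} {L} (_ , units) {x} x∈K∩L
      with x ∈? S | x∈p∩q⁻ K L x∈K∩L | units
    ... | yes x∈S | _           | _                = x∈S
    ... | no  x∉S | x∈K , x∈L | inj₁ (R~K , R′~L) =
      ⊥-elim (¬ab (Reaches-join (SameUnit⇒Reaches R~K reachesR) (SameUnit⇒Reaches R′~L reachesR′) x∈K x∈L x∉S))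
    ... | no  x∉S | x∈K , x∈L | inj₂ (R′~K , R~L) =
      ⊥-elim (¬ab (Reaches-join (SameUnit⇒Reaches R~L reachesR) (SameUnit⇒Reaches R′~K reachesR′) x∈L x∈K x∉S))

  crossing-label⊆crossing-label : ∀ {R R′ K₁ K₂ K₃ K₄ u v} → IsMinWeight G (weight G K₁ K₂) →
    Crosses G R R′ K₁ K₂ → Crosses G R R′ K₃ K₄ →
    u ∈ K₁ → u ∉ K₂ → v ∈ K₂ → v ∉ K₁ → K₃ ∩ K₄ ⊆ K₁ ∩ K₂
  crossing-label⊆crossing-label {R} {R′} {K₁} {K₂} {K₃} {K₄} {u} {v}
    min ((mK₁ , mK₂ , _ , sep) , units) c₂ u∈K₁ u∉K₂ v∈K₂ v∉K₁ = by-orientation units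
    where
      open MinWeightSeparator (K₁ ∩ K₂) min

      ¬uv : ¬ PathAvoiding G (K₁ ∩ K₂) u v
      ¬uv = proj₂ (proj₂ (proj₁ (sep u v u∈K₁ u∉K₂ v∈K₂ v∉K₁)))

      u-reaches : Reaches (K₁ ∩ K₂) u K₁
      u-reaches = Clique⇒Reaches (proj₁ mK₁) u∈K₁ (∉∩ʳ K₁ u∉K₂) (stop (∉∩ʳ K₁ u∉K₂))

      v-reaches : Reaches (K₁ ∩ K₂) v K₂
      v-reaches = Clique⇒Reaches (proj₁ mK₂) v∈K₂ (∉∩ˡ K₂ v∉K₁) (stop (∉∩ˡ K₂ v∉K₁))

      by-orientation : (SameUnit G R K₁ × SameUnit G R′ K₂) ⊎ (SameUnit G R′ K₁ × SameUnit G R K₂) →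
                       K₃ ∩ K₄ ⊆ K₁ ∩ K₂
      by-orientation (inj₁ (R~K₁ , R′~K₂)) =
        crossing-label⊆ ¬uv (SameUnit⇒Reaches (SameUnit-sym R~K₁) u-reaches)
                            (SameUnit⇒Reaches (SameUnit-sym R′~K₂) v-reaches) c₂
      by-orientation (inj₂ (R′~K₁ , R~K₂)) =
        crossing-label⊆ (¬uv ∘ reverse) (SameUnit⇒Reaches (SameUnit-sym R~K₂) v-reaches)
                                        (SameUnit⇒Reaches (SameUnit-sym R′~K₁) u-reaches) c₂

open RawMonad {f = 0ℓ} ¬¬-Monad

lemma6 : ∀ {n} (G : Graph n) → Connected G → Chordal G →
    ∀ (R R' : Subset n) → MaximalClique G R → MaximalClique G R' →
    ¬ SameUnit G R R' →
    (∃₂ λ K K' → Crosses G R R' K K') →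
    ∀ K₁ K₂ K₃ K₄ → Crosses G R R' K₁ K₂ → Crosses G R R' K₃ K₄ →
    label G K₁ K₂ ≡ label G K₃ K₄
lemma6 G _ _ R R′ _ _ ¬R~R′ _ K₁ K₂ K₃ K₄ c₁ c₂ =
  decidable-stable (≡-dec _≟ᵇ_ (label G K₁ K₂) (label G K₃ K₄)) do
    min₁ ← ¬kept⇒weight-min G (proj₁ c₁) (crossing-not-kept G ¬R~R′ c₁)
    min₂ ← ¬kept⇒weight-min G (proj₁ c₂) (crossing-not-kept G ¬R~R′ c₂)
    (u , u∈K₁ , u∉K₂) ← CEdge⇒¬¬∃∈∖ G (proj₁ c₁)
    (v , v∈K₂ , v∉K₁) ← CEdge⇒¬¬∃∈∖ G (CEdge-sym G (proj₁ c₁))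
    pure (sym (p⊆q∧∣q∣≤∣p∣⇒p≡q
      (crossing-label⊆crossing-label G min₁ c₁ c₂ u∈K₁ u∉K₂ v∈K₂ v∉K₁)
      (≤-reflexive (IsMinWeight-unique G min₁ min₂))))
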